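{- Let $M$ be a square $\{0,1\}$-matrix with exactly $k$ diagonal entries equal to $0$ and exactly $\ell$ diagonal entries equal to $1$, and let $D$ be a minimal $M$-obstruction. If $D$ does not contain a pair of false twins and $\ell=0$, then $|V(D)|\le k+1$. Similarly, if $D$ does not contain a pair of true twins and $k=0$, then $|V(D)|\le \ell+1$.
   Context: Digraphs are finite, without loops and multiple arcs. A strong clique: set $C$ with both $(x,y),(y,x)$ arcs for all distinct $x,y\in C$; an independent set: set with no arcs between any two of its vertices. For disjoint $S,S'$, $S$ is completely adjacent (resp. completely non-adjacent) to $S'$ if $(x,x')$ is an arc for all (resp. no) $x\in S,x'\in S'$. An $M$-partition of $D$ ($M$ of size $k+\ell$) is a partition of $V(D)$ into possibly empty parts $V_1,\dots,V_{k+\ell}$ with $V_i$ independent if $M(i,i)=0$, a strong clique if $M(i,i)=1$, and for $i\ne j$, $V_i$ completely non-adjacent to $V_j$ if $M(i,j)=0$ and completely adjacent to $V_j$ if $M(i,j)=1$. A minimal $M$-obstruction is a digraph with no $M$-partition such that $D-v$ has an $M$-partition for every vertex $v$. For distinct vertices $u,v,w$, $w$ distinguishes $u,v$ if exactly one of $u,v$ is an in-neighbour of $w$ or exactly one is an out-neighbour of $w$; distinct $u,v$ are twins if no vertex distinguishes them; true twins if moreover both $(u,v),(v,u)$ are arcs, false twins if neither is an arc. -}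

module Defs where

open import Data.Nat using (ℕ; suc)
open import Data.Bool using (Bool; true; false; not)
open import Data.Fin using (Fin; punchIn)
open import Data.List using (List; length; filterᵇ; allFin)
open import Data.Product using (Σ; _×_; _,_)
open import Relation.Binary.PropositionalEquality using (_≡_; _≢_)
open import Relation.Nullary using (¬_)
open import Data.Unit using (⊤)

-- A digraph on vertex set Fin n: arc relation as a Boolean matrix,
-- loopless (multiple arcs impossible by construction).
record Digraph (n : ℕ) : Set where
  field
    arc      : Fin n → Fin n → Bool
    loopless : ∀ x → arc x x ≡ false
open Digraph public

Matrix : ℕ → Set
Matrix m = Fin m → Fin m → Bool

zeroDiag : ∀ {m} → Matrix m → ℕ
zeroDiag {m} M = length (filterᵇ (λ i → not (M i i)) (allFin m))

oneDiag : ∀ {m} → Matrix m → ℕ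
oneDiag {m} M = length (filterᵇ (λ i → M i i) (allFin m))

-- Part i: independent if M i i = 0, strong clique if M i i = 1
-- (for distinct vertices in the same part: arc present iff M i i = 1);
-- for distinct parts i ≠ j: arc x→y (x∈V_i, y∈V_j) present iff M i j = 1.
record MPartition {m n : ℕ} (M : Matrix m) (D : Digraph n) : Set where
  field
    part      : Fin n → Fin m
    sameRule  : ∀ x y → x ≢ y → part x ≡ part y → arc D x y ≡ M (part x) (part x)
    crossRule : ∀ x y → part x ≢ part y → arc D x y ≡ M (part x) (part y)

deleteVertex : ∀ {n} → Digraph (suc n) → Fin (suc n) → Digraph n
deleteVertex D v = record
  { arc      = λ x y → arc D (punchIn v x) (punchIn v y)
  ; loopless = λ x → loopless D (punchIn v x) }

MinimalObstruction : ∀ {m n} → Matrix m → Digraph n → Set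
MinimalObstruction {m} {0} M D = ¬ MPartition M D × ⊤  -- no vertex to delete
MinimalObstruction {m} {suc n} M D =
  ¬ MPartition M D × (∀ v → MPartition M (deleteVertex D v))

-- w distinguishes u, v (u, v, w distinct is required by the caller)
Distinguishes : ∀ {n} → Digraph n → Fin n → Fin n → Fin n → Set
Distinguishes D w u v = ¬ (arc D u w ≡ arc D v w) Data.Sum.⊎ ¬ (arc D w u ≡ arc D w v)
  where import Data.Sum

Twins : ∀ {n} → Digraph n → Fin n → Fin n → Set
Twins D u v = u ≢ v × (∀ w → w ≢ u → w ≢ v → ¬ Distinguishes D w u v)

TrueTwins : ∀ {n} → Digraph n → Fin n → Fin n → Set
TrueTwins D u v = Twins D u v × arc D u v ≡ true × arc D v u ≡ true

FalseTwins : ∀ {n} → Digraph n → Fin n → Fin n → Set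
FalseTwins D u v = Twins D u v × arc D u v ≡ false × arc D v u ≡ false

-- Let all diagonal entries of M equal d, and let D have no twins joined by
-- d-arcs both ways. If |V(D)| ≥ m + 2, then for each vertex v the M-partition
-- of D − v has two vertices x, y in a common part: they are d-joined both ways
-- and twins in D − v, so v is the only vertex distinguishing them; call {x, y}
-- the pair of v. If u is in the pair of v then v is in the pair of u, so every
-- vertex lies in exactly two pairs. Now fix z and a member x of its pair that
-- is not d-joined to z both ways (z distinguishes its pair, so one exists),
-- and count, over all pairs, the members other than z that see z as x does.
-- Each vertex is counted twice, so the total is even; yet the pair of z
-- contributes 1 and every other pair contributes 0 or 2.
module Submission where

open import Defs
open import Data.Bool using (Bool; true; false; not; T?)
import Data.Bool as Bool
open import Data.Bool.Properties using (T-≡; not-injective)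
open import Data.Fin using (Fin; zero; suc; punchIn)
open import Data.Fin.Properties as Fin using (_≟_; punchInᵢ≢i; punchIn-injective; punchIn-punchOut; pigeonhole)
open import Data.List using (length; filterᵇ; allFin)
open import Data.List.Properties using (filter-all; filter-some; length-tabulate)
import Data.List.Relation.Unary.All.Properties as All
import Data.List.Relation.Unary.Any.Properties as Any
open import Data.Nat using (ℕ; zero; suc; _+_; _*_; _≤_; _<_; z≤n; s≤s)
open import Data.Nat.Properties
  using (+-*-semiring; +-identityʳ; +-comm; *-distribʳ-+; even≢odd; _≤?_; ≰⇒>; n>0⇒n≢0)
open import Data.Product using (Σ-syntax; _×_; _,_; proj₁; proj₂; swap)
open import Data.Product.Properties using (≡-dec)
open import Data.Sum using (_⊎_; inj₁; inj₂)
open import Data.Empty using (⊥; ⊥-elim)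
open import Function using (_∘_; id; mk⇔; Equivalence)
open import Relation.Binary.Definitions using (DecidableEquality)
open import Relation.Binary.PropositionalEquality
open import Relation.Nullary using (¬_; Dec; yes; no; does; ¬?; _×-dec_; _⊎-dec_)
open import Relation.Nullary.Decidable using (dec-true; dec-false; does-⇔)
open import Relation.Nullary.Negation using (contradiction)
open import Algebra.Properties.Semiring.Sum +-*-semiring
  using (sum; sum-syntax; sum-cong-≗; sum-remove; sum-replicate-zero; ∑-distrib-+; ∑-comm; *-distribˡ-sum)

𝟙 : Bool → ℕ
𝟙 true  = 1
𝟙 false = 0

δ : ∀ {n} → Fin n → Fin n → ℕ
δ i u = 𝟙 (does (u ≟ i))

sum-δ : ∀ {n} (i : Fin n) (f : Fin n → ℕ) → ∑[ u < n ] (δ i u * f u) ≡ f i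
sum-δ {suc n} zero    f = trans (cong (f zero + 0 +_) (sum-replicate-zero n))
                                (trans (+-identityʳ _) (+-identityʳ _))
sum-δ {suc n} (suc i) f = sum-δ i (f ∘ suc)

sum-with-one-odd-term≢even : ∀ {n} (f g : Fin n → ℕ) (z : Fin n) → f z ≡ 1 →
  (∀ v → v ≢ z → f v ≡ 2 * g v) → ∀ m → ∑[ v < n ] (f v) ≢ 2 * m
sum-with-one-odd-term≢even {suc n} f g z fz≡1 even m ∑f≡2m =
  even≢odd m (∑[ j < n ] (g (punchIn z j))) (begin
    2 * m                                 ≡⟨ sym ∑f≡2m ⟩
    sum f                                 ≡⟨ sum-remove f ⟩
    f z + ∑[ j < n ] (f (punchIn z j))    ≡⟨ cong₂ _+_ fz≡1 (sum-cong-≗ λ j → even (punchIn z j) (punchInᵢ≢i z j)) ⟩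
    1 + ∑[ j < n ] (2 * g (punchIn z j))  ≡⟨ cong suc (sym (*-distribˡ-sum 2 (g ∘ punchIn z))) ⟩
    1 + 2 * ∑[ j < n ] (g (punchIn z j))  ∎)
  where open ≡-Reasoning

module Pairs {n : ℕ} (a b : Fin n → Fin n) (a≢b : ∀ v → a v ≢ b v)
             (reciprocal : ∀ {u v} → u ≡ a v ⊎ u ≡ b v → v ≡ a u ⊎ v ≡ b u) where

  _∈pair?_ : ∀ u v → Dec (u ≡ a v ⊎ u ≡ b v)
  u ∈pair? v = (u ≟ a v) ⊎-dec (u ≟ b v)

  χ : Fin n → Fin n → ℕ
  χ v u = 𝟙 (does (u ∈pair? v))

  χ-split : ∀ v u → χ v u ≡ δ (a v) u + δ (b v) u
  χ-split v u with u ≟ a v | u ≟ b v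
  ... | yes refl | yes u≡b = contradiction u≡b (a≢b v)
  ... | yes _    | no _    = refl
  ... | no _     | yes _   = refl
  ... | no _     | no _    = refl

  χ-sym : ∀ v u → χ v u ≡ χ u v
  χ-sym v u = cong 𝟙 (does-⇔ (mk⇔ reciprocal reciprocal) (u ∈pair? v) (v ∈pair? u))

  ∑-χ : ∀ v (f : Fin n → ℕ) → ∑[ u < n ] (χ v u * f u) ≡ f (a v) + f (b v)
  ∑-χ v f = begin
    ∑[ u < n ] (χ v u * f u)
      ≡⟨ sum-cong-≗ (λ u → trans (cong (_* f u) (χ-split v u)) (*-distribʳ-+ (f u) (δ (a v) u) (δ (b v) u))) ⟩
    ∑[ u < n ] (δ (a v) u * f u + δ (b v) u * f u)
      ≡⟨ ∑-distrib-+ (λ u → δ (a v) u * f u) (λ u → δ (b v) u * f u) ⟩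
    ∑[ u < n ] (δ (a v) u * f u) + ∑[ u < n ] (δ (b v) u * f u)
      ≡⟨ cong₂ _+_ (sum-δ (a v) f) (sum-δ (b v) f) ⟩
    f (a v) + f (b v) ∎
    where open ≡-Reasoning

  handshake : ∀ (t : Fin n → ℕ) → ∑[ v < n ] (t (a v) + t (b v)) ≡ 2 * ∑[ u < n ] (t u)
  handshake t = begin
    ∑[ v < n ] (t (a v) + t (b v))       ≡⟨ sum-cong-≗ (λ v → sym (∑-χ v t)) ⟩
    ∑[ v < n ] ∑[ u < n ] (χ v u * t u)  ≡⟨ ∑-comm (λ v u → χ v u * t u) ⟩
    ∑[ u < n ] ∑[ v < n ] (χ v u * t u)  ≡⟨ sum-cong-≗ (λ u → sum-cong-≗ λ v → cong (_* t u) (χ-sym v u)) ⟩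
    ∑[ u < n ] ∑[ v < n ] (χ u v * t u)  ≡⟨ sum-cong-≗ (λ u → ∑-χ u (λ _ → t u)) ⟩
    ∑[ u < n ] (t u + t u)               ≡⟨ sum-cong-≗ (λ u → cong (t u +_) (sym (+-identityʳ (t u)))) ⟩
    ∑[ u < n ] (2 * t u)                 ≡⟨ sym (*-distribˡ-sum 2 t) ⟩
    2 * ∑[ u < n ] (t u)                 ∎
    where open ≡-Reasoning

  no-lone-odd-pair : ∀ (t : Fin n → ℕ) z → (∀ v → v ≢ z → t (a v) ≡ t (b v)) →
                     t (a z) + t (b z) ≢ 1
  no-lone-odd-pair t z balanced odd =
    sum-with-one-odd-term≢even (λ v → t (a v) + t (b v)) (t ∘ a) z odd
      (λ v v≢z → cong (t (a v) +_) (trans (sym (balanced v v≢z)) (sym (+-identityʳ _))))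
      (∑[ u < n ] (t u)) (handshake t)

profile : ∀ {n} → Digraph n → Fin n → Fin n → Bool × Bool
profile D w x = arc D x w , arc D w x

same-profile⇒¬distinguishes : ∀ {n} (D : Digraph n) {w u v} →
  profile D w u ≡ profile D w v → ¬ Distinguishes D w u v
same-profile⇒¬distinguishes D same (inj₁ ne) = ne (cong proj₁ same)
same-profile⇒¬distinguishes D same (inj₂ ne) = ne (cong proj₂ same)

NoTwinsJoinedBy : ∀ {n} → Digraph n → Bool → Set
NoTwinsJoinedBy D d = ∀ u v → ¬ (Twins D u v × arc D u v ≡ d × arc D v u ≡ d)

_≟ₚ_ : DecidableEquality (Bool × Bool)
_≟ₚ_ = ≡-dec Bool._≟_ Bool._≟_

module _ {n : ℕ} (D : Digraph n) (d : Bool) where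

  -- What two vertices sharing a part of an M-partition of D − v with diagonal entry d satisfy.
  record DeletionTwins (v x y : Fin n) : Set where
    field
      distinct : x ≢ y
      fst≢del  : x ≢ v
      snd≢del  : y ≢ v
      joined   : profile D x y ≡ (d , d)
      agree    : ∀ w → w ≢ x → w ≢ y → w ≢ v → profile D w x ≡ profile D w y
  open DeletionTwins

  DeletionTwins-sym : ∀ {v x y} → DeletionTwins v x y → DeletionTwins v y x
  DeletionTwins-sym t = record
    { distinct = ≢-sym (distinct t)
    ; fst≢del  = snd≢del t
    ; snd≢del  = fst≢del t
    ; joined   = cong swap (joined t)
    ; agree    = λ w w≢y w≢x w≢v → sym (agree t w w≢x w≢y w≢v)
    }

  module _ (noTwins : NoTwinsJoinedBy D d) where

    deleted-distinguishes : ∀ {v x y} → DeletionTwins v x y → profile D v x ≢ profile D v y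
    deleted-distinguishes {v} {x} {y} t same =
      noTwins x y ((distinct t , λ w w≢x w≢y → same-profile⇒¬distinguishes D (agree′ w w≢x w≢y))
                  , cong proj₂ (joined t) , cong proj₁ (joined t))
      where
      agree′ : ∀ w → w ≢ x → w ≢ y → profile D w x ≡ profile D w y
      agree′ w w≢x w≢y with w ≟ v
      ... | yes refl = same
      ... | no w≢v   = agree t w w≢x w≢y w≢v

    private
      twin-blind-to-own-pair : ∀ {u x y a b} → DeletionTwins u x y → DeletionTwins x a b →
                         u ≢ a → u ≢ b → y ≢ b → profile D x a ≡ profile D x b
      twin-blind-to-own-pair {u} {x} {y} {a} {b} tu tx u≢a u≢b y≢b with y ≟ a
      ... | yes refl = begin
        profile D x y  ≡⟨ joined tu ⟩
        (d , d)        ≡⟨ sym (joined tx) ⟩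
        profile D y b  ≡⟨ cong swap (sym (agree tu b (snd≢del tx) (≢-sym y≢b) (≢-sym u≢b))) ⟩
        profile D x b  ∎
        where open ≡-Reasoning
      ... | no y≢a = begin
        profile D x a  ≡⟨ cong swap (agree tu a (fst≢del tx) (≢-sym y≢a) (≢-sym u≢a)) ⟩
        profile D y a  ≡⟨ agree tx y y≢a y≢b (≢-sym (distinct tu)) ⟩
        profile D y b  ≡⟨ cong swap (sym (agree tu b (snd≢del tx) (≢-sym y≢b) (≢-sym u≢b))) ⟩
        profile D x b  ∎
        where open ≡-Reasoning

    deleted-in-pair : ∀ {u x y a b} → DeletionTwins u x y → DeletionTwins x a b → u ≡ a ⊎ u ≡ b
    deleted-in-pair {u} {x} {y} {a} {b} tu tx with u ≟ a | u ≟ b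
    ... | yes u≡a | _       = inj₁ u≡a
    ... | no _    | yes u≡b = inj₂ u≡b
    ... | no u≢a  | no u≢b with y ≟ b
    ... | no y≢b   = ⊥-elim (deleted-distinguishes tx (twin-blind-to-own-pair tu tx u≢a u≢b y≢b))
    ... | yes refl = ⊥-elim (deleted-distinguishes (DeletionTwins-sym tx)
                       (twin-blind-to-own-pair tu (DeletionTwins-sym tx) u≢b u≢a (≢-sym (distinct tx))))

    module SeeingLike (z : Fin n) (c : Bool × Bool) where

      sees-like? : ∀ u → Dec (u ≢ z × profile D z u ≡ c)
      sees-like? u = ¬? (u ≟ z) ×-dec (profile D z u ≟ₚ c)

      member : Fin n → ℕ
      member u = 𝟙 (does (sees-like? u))

      member-∈ : ∀ {u} → u ≢ z → profile D z u ≡ c → member u ≡ 1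
      member-∈ {u} u≢z p = cong 𝟙 (dec-true (sees-like? u) (u≢z , p))

      member-∉ : ∀ {u} → ¬ (u ≢ z × profile D z u ≡ c) → member u ≡ 0
      member-∉ {u} ∉ = cong 𝟙 (dec-false (sees-like? u) ∉)

      member-joined : c ≢ (d , d) → ∀ {u} → profile D z u ≡ (d , d) → member u ≡ 0
      member-joined c≢dd dd = member-∉ λ (_ , p) → c≢dd (trans (sym p) dd)

      member-balanced : c ≢ (d , d) → ∀ {v x y} → DeletionTwins v x y → v ≢ z → member x ≡ member y
      member-balanced c≢dd {v} {x} {y} t v≢z = by-cases (x ≟ z) (y ≟ z)
        where
        by-cases : Dec (x ≡ z) → Dec (y ≡ z) → member x ≡ member y
        by-cases (yes refl) _ =
          trans (member-∉ λ (x≢z , _) → x≢z refl) (sym (member-joined c≢dd (joined t)))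
        by-cases (no _) (yes refl) =
          trans (member-joined c≢dd (cong swap (joined t))) (sym (member-∉ λ (y≢z , _) → y≢z refl))
        by-cases (no x≢z) (no y≢z) = cong 𝟙 (does-⇔
          (mk⇔ (λ (_ , p) → y≢z , trans (sym same) p) (λ (_ , p) → x≢z , trans same p))
          (sees-like? x) (sees-like? y))
          where same = agree t z (≢-sym x≢z) (≢-sym y≢z) (≢-sym v≢z)

      member-of-own-pair : ∀ {x y} → DeletionTwins z x y → c ≡ profile D z x → member x + member y ≡ 1
      member-of-own-pair t refl =
        cong₂ _+_ (member-∈ (fst≢del t) refl) (member-∉ λ (_ , p) → deleted-distinguishes t (sym p))

    deletion-twins-not-everywhere : Fin n → ¬ (∀ v → Σ[ x ∈ Fin n ] Σ[ y ∈ Fin n ] DeletionTwins v x y)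
    deletion-twins-not-everywhere z pair = by-colour (profile D z (a z) ≟ₚ (d , d))
      where
      a b : Fin n → Fin n
      a v = proj₁ (pair v)
      b v = proj₁ (proj₂ (pair v))

      twins : ∀ v → DeletionTwins v (a v) (b v)
      twins v = proj₂ (proj₂ (pair v))

      reciprocal : ∀ {u v} → u ≡ a v ⊎ u ≡ b v → v ≡ a u ⊎ v ≡ b u
      reciprocal {v = v} (inj₁ refl) = deleted-in-pair (twins v) (twins (a v))
      reciprocal {v = v} (inj₂ refl) = deleted-in-pair (DeletionTwins-sym (twins v)) (twins (b v))

      open Pairs a b (distinct ∘ twins) reciprocal

      -- The other member of a pair containing z is d-joined to z both ways; hence c ≢ (d , d).
      colour-impossible : ∀ c → c ≢ (d , d) →
        SeeingLike.member z c (a z) + SeeingLike.member z c (b z) ≢ 1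
      colour-impossible c c≢dd = no-lone-odd-pair member z (λ v → member-balanced c≢dd (twins v))
        where open SeeingLike z c

      by-colour : Dec (profile D z (a z) ≡ (d , d)) → ⊥
      by-colour (no ≢dd) = colour-impossible _ ≢dd (member-of-own-pair (twins z) refl)
        where open SeeingLike z (profile D z (a z))
      by-colour (yes ≡dd) =
        colour-impossible _ (λ ≡dd′ → deleted-distinguishes (twins z) (trans ≡dd (sym ≡dd′)))
          (trans (+-comm (member (a z)) (member (b z))) (member-of-own-pair (DeletionTwins-sym (twins z)) refl))
        where open SeeingLike z (profile D z (b z))

module _ {m k} {M : Matrix m} {E : Digraph k} (P : MPartition M E) where
  open MPartition P

  arc-by-parts : ∀ {x y} → x ≢ y → arc E x y ≡ M (part x) (part y)
  arc-by-parts {x} {y} x≢y with part x Fin.≟ part y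
  ... | yes same = trans (sameRule x y x≢y same) (cong (M (part x)) same)
  ... | no differ = crossRule x y differ

  same-part-joined : ∀ {x y} → x ≢ y → part x ≡ part y →
                     profile E x y ≡ (M (part x) (part x) , M (part x) (part x))
  same-part-joined {x} {y} x≢y same =
    cong₂ _,_ (trans (sameRule y x (≢-sym x≢y) (sym same)) (cong (λ p → M p p) (sym same)))
              (sameRule x y x≢y same)

  same-part-agree : ∀ {x y w} → part x ≡ part y → w ≢ x → w ≢ y → profile E w x ≡ profile E w y
  same-part-agree {x} {y} {w} same w≢x w≢y =
    cong₂ _,_ (trans (arc-by-parts (≢-sym w≢x)) (trans (cong (λ p → M p (part w)) same) (sym (arc-by-parts (≢-sym w≢y)))))
              (trans (arc-by-parts w≢x) (trans (cong (M (part w)) same) (sym (arc-by-parts w≢y))))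

deletion-twins-of-partition : ∀ {m n} {M : Matrix m} {D : Digraph (suc n)} {d} →
  (∀ i → M i i ≡ d) → m < n → ∀ v → MPartition M (deleteVertex D v) →
  Σ[ x ∈ Fin (suc n) ] Σ[ y ∈ Fin (suc n) ] DeletionTwins D d v x y
deletion-twins-of-partition {D = D} diag m<n v P with pigeonhole m<n (MPartition.part P)
... | i , j , i<j , same = punchIn v i , punchIn v j , record
  { distinct = i≢j ∘ punchIn-injective v i j
  ; fst≢del  = punchInᵢ≢i v i
  ; snd≢del  = punchInᵢ≢i v j
  ; joined   = trans (same-part-joined P i≢j same) (cong₂ _,_ (diag _) (diag _))
  ; agree    = agree
  }
  where
  i≢j = Fin.<⇒≢ i<j

  agree : ∀ w → w ≢ punchIn v i → w ≢ punchIn v j → w ≢ v →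
          profile D w (punchIn v i) ≡ profile D w (punchIn v j)
  agree w w≢x w≢y w≢v =
    subst (λ u → profile D u (punchIn v i) ≡ profile D u (punchIn v j)) w′↦w
      (same-part-agree P same (λ w′≡i → w≢x (trans (sym w′↦w) (cong (punchIn v) w′≡i)))
                              (λ w′≡j → w≢y (trans (sym w′↦w) (cong (punchIn v) w′≡j))))
    where w′↦w = punchIn-punchOut (≢-sym w≢v)

partitionable-deletions-order-bound : ∀ {m n} {M : Matrix m} (D : Digraph (suc n)) (d : Bool) →
  (∀ i → M i i ≡ d) → NoTwinsJoinedBy D d → (∀ v → MPartition M (deleteVertex D v)) → n ≤ m
partitionable-deletions-order-bound {m} {n} D d diag noTwins partitions with n ≤? m
... | yes n≤m = n≤m
... | no n≰m  = ⊥-elim (deletion-twins-not-everywhere D d noTwins zero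
                 (λ v → deletion-twins-of-partition diag (≰⇒> n≰m) v (partitions v)))

minimalObstruction-order : ∀ {m n} {M : Matrix m} (D : Digraph n) (d : Bool) → (∀ i → M i i ≡ d) →
  NoTwinsJoinedBy D d → MinimalObstruction M D → n ≤ suc m
minimalObstruction-order {n = zero}  D d diag noTwins _                = z≤n
minimalObstruction-order {n = suc n} D d diag noTwins (_ , partitions) =
  s≤s (partitionable-deletions-order-bound D d diag noTwins partitions)

length-filterᵇ≡0⇒false : ∀ {m} (p : Fin m → Bool) → length (filterᵇ p (allFin m)) ≡ 0 → ∀ i → p i ≡ false
length-filterᵇ≡0⇒false p none i with p i in pᵢ
... | false = refl
... | true  = contradiction none (n>0⇒n≢0 (filter-some (T? ∘ p) (Any.tabulate⁺ i (Equivalence.from T-≡ pᵢ))))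

length-filterᵇ-allFin : ∀ {m} (p : Fin m → Bool) → (∀ i → p i ≡ true) → length (filterᵇ p (allFin m)) ≡ m
length-filterᵇ-allFin p all = trans (cong length (filter-all (T? ∘ p) (All.tabulate⁺ (Equivalence.from T-≡ ∘ all))))
                        (length-tabulate id)

lemma3 : ∀ {m n : ℕ} (M : Matrix m) (D : Digraph n) →
    MinimalObstruction M D →
    ((∀ u v → ¬ FalseTwins D u v) → oneDiag M ≡ 0 → n ≤ suc (zeroDiag M))
    × ((∀ u v → ¬ TrueTwins D u v) → zeroDiag M ≡ 0 → n ≤ suc (oneDiag M))
lemma3 {m} {n} M D obstruction = without-false-twins , without-true-twins
  where
  without-false-twins : (∀ u v → ¬ FalseTwins D u v) → oneDiag M ≡ 0 → n ≤ suc (zeroDiag M)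
  without-false-twins noTwins noOnes =
    subst (λ k → n ≤ suc k) (sym (length-filterᵇ-allFin _ (cong not ∘ diag)))
      (minimalObstruction-order D false diag noTwins obstruction)
    where diag = length-filterᵇ≡0⇒false (λ i → M i i) noOnes

  without-true-twins : (∀ u v → ¬ TrueTwins D u v) → zeroDiag M ≡ 0 → n ≤ suc (oneDiag M)
  without-true-twins noTwins noZeros =
    subst (λ k → n ≤ suc k) (sym (length-filterᵇ-allFin _ diag))
      (minimalObstruction-order D true diag noTwins obstruction)
    where diag = not-injective ∘ length-filterᵇ≡0⇒false (λ i → not (M i i)) noZeros
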